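{- In the logic $\operatorname{SŁ}^1_\omega$, the quotient set $\operatorname{Form}/\!\sim_{\blacktriangleleft}$ becomes a CMV-algebra when equipped with the operations and constants $|\alpha|\to|\beta|:=|\alpha\to\beta|$, $|\alpha|^*:=|\neg\alpha|$, $|\alpha|\diamond|\beta|:=|\alpha\blacktriangleleft\beta|$, $1:=\operatorname{Th}$, $i:=|v|$ (with the MV-operations $x\oplus y:=x^*\to y$ and $0:=1^*$).
   Context: Formulas ($\operatorname{Form}$) of $\operatorname{SŁ}^1_\omega$: the single variable $v$ is a formula; if $\alpha,\beta$ are formulas, so are $\neg\alpha$, $\alpha\to\beta$ and $\alpha\blacktriangleleft\beta$. Axioms (for all formulas $\varphi,\psi,\chi,\gamma$): Ax1 $\varphi\to(\psi\to\varphi)$; Ax2 $(\varphi\to\psi)\to((\psi\to\chi)\to(\varphi\to\chi))$; Ax3 $((\varphi\to\psi)\to\psi)\to((\psi\to\varphi)\to\varphi)$; Ax4 $(\neg\varphi\to\neg\psi)\to(\psi\to\varphi)$; Ax5 $(\varphi\blacktriangleleft v)\to\varphi$; Ax6 $(v\blacktriangleleft\varphi)\to\varphi$; Ax7 $\varphi\to(v\blacktriangleleft\varphi)$; Ax8 $\varphi\to(\varphi\blacktriangleleft v)$; Ax9 $((\varphi\to\psi)\blacktriangleleft\gamma)\to((\varphi\blacktriangleleft\gamma)\to(\psi\blacktriangleleft\gamma))$; Ax10 $((\neg\varphi\to\psi)\blacktriangleleft\gamma)\to(\neg(\varphi\blacktriangleleft\gamma)\to(\psi\blacktriangleleft\gamma))$;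 Ax11 $(\neg(\varphi\blacktriangleleft\gamma)\to(\psi\blacktriangleleft\gamma))\to((\neg\varphi\to\psi)\blacktriangleleft\gamma)$; Ax12 $(\varphi\blacktriangleleft(\psi\blacktriangleleft\gamma))\to((\varphi\blacktriangleleft\psi)\blacktriangleleft\gamma)$; Ax13 $((\varphi\blacktriangleleft\psi)\blacktriangleleft\gamma)\to(\varphi\blacktriangleleft(\psi\blacktriangleleft\gamma))$; Ax14 $\neg(\varphi\blacktriangleleft\psi)\to(\neg\varphi\blacktriangleleft\psi)$; Ax15 $(\neg\varphi\blacktriangleleft\psi)\to\neg(\varphi\blacktriangleleft\psi)$. Inference rules: Modus Ponens (from $\alpha$ and $\alpha\to\beta$ infer $\beta$); $\blacktriangleleft$-rule (from $\alpha$ infer $\alpha\blacktriangleleft\beta$); Arrow $\blacktriangleleft$-rule (from $\alpha$ infer $\alpha\to(\alpha\blacktriangleleft\beta)$). $\vdash\alpha$ means $\alpha$ is derivable; $\operatorname{Th}$ is the set of derivable formulas. $\alpha\sim_{\blacktriangleleft}\beta$ iff $\vdash\alpha\to\beta$ and $\vdash\beta\to\alpha$; $|\alpha|$ is the class of $\alpha$. An MV-algebra is a structure $\langle A,\oplus,{}^*,0\rangle$ satisfying $(x\oplus y)\oplus z=x\oplus(y\oplus z)$, $x\oplus y=y\oplus x$, $x\oplus 0=x$, $(x^*)^*=x$, $x\oplus 0^*=0^*$, $(x^*\oplus y)^*\oplus y=(y^*\oplus x)^*\oplus x$ (with $x\to y:=x^*\oplus y$, $1=0^*$). A CMV-algebra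 is an MV-algebra with a monoid $\langle A,\diamond,i\rangle$ such that $(y\oplus z)\diamond x=(y\diamond x)\oplus(z\diamond x)$, $x^*\diamond y=(x\diamond y)^*$, $0\diamond x=0$. -}

module Defs where

open import Data.Product using (_×_; _,_)
open import Relation.Binary.Structures using (IsEquivalence)
open import Relation.Binary.Core using (Rel)
open import Algebra.Structures using (IsMonoid)
open import Level using (Level; suc; _⊔_)

infix  30 ¬_
infixl 25 _◂_
infixr 20 _⇒_

data Form : Set where
  v   : Form
  ¬_  : Form → Form
  _⇒_ : Form → Form → Form
  _◂_ : Form → Form → Form

-- Derivability ⊢ α  (Th = { α | ⊢ α })

infix 5 ⊢_

data ⊢_ : Form → Set where
  ax1  : ∀ φ ψ → ⊢ φ ⇒ (ψ ⇒ φ)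
  ax2  : ∀ φ ψ χ → ⊢ (φ ⇒ ψ) ⇒ ((ψ ⇒ χ) ⇒ (φ ⇒ χ))
  ax3  : ∀ φ ψ → ⊢ ((φ ⇒ ψ) ⇒ ψ) ⇒ ((ψ ⇒ φ) ⇒ φ)
  ax4  : ∀ φ ψ → ⊢ (¬ φ ⇒ ¬ ψ) ⇒ (ψ ⇒ φ)
  ax5  : ∀ φ → ⊢ (φ ◂ v) ⇒ φ
  ax6  : ∀ φ → ⊢ (v ◂ φ) ⇒ φ
  ax7  : ∀ φ → ⊢ φ ⇒ (v ◂ φ)
  ax8  : ∀ φ → ⊢ φ ⇒ (φ ◂ v)
  ax9  : ∀ φ ψ γ → ⊢ ((φ ⇒ ψ) ◂ γ) ⇒ ((φ ◂ γ) ⇒ (ψ ◂ γ))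
  ax10 : ∀ φ ψ γ → ⊢ ((¬ φ ⇒ ψ) ◂ γ) ⇒ (¬ (φ ◂ γ) ⇒ (ψ ◂ γ))
  ax11 : ∀ φ ψ γ → ⊢ (¬ (φ ◂ γ) ⇒ (ψ ◂ γ)) ⇒ ((¬ φ ⇒ ψ) ◂ γ)
  ax12 : ∀ φ ψ γ → ⊢ (φ ◂ (ψ ◂ γ)) ⇒ ((φ ◂ ψ) ◂ γ)
  ax13 : ∀ φ ψ γ → ⊢ ((φ ◂ ψ) ◂ γ) ⇒ (φ ◂ (ψ ◂ γ))
  ax14 : ∀ φ ψ → ⊢ ¬ (φ ◂ ψ) ⇒ (¬ φ ◂ ψ)
  ax15 : ∀ φ ψ → ⊢ (¬ φ ◂ ψ) ⇒ ¬ (φ ◂ ψ)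
  mp       : ∀ {α β} → ⊢ α → ⊢ α ⇒ β → ⊢ β
  ◂-rule   : ∀ {α} β → ⊢ α → ⊢ α ◂ β
  ⇒◂-rule  : ∀ {α} β → ⊢ α → ⊢ α ⇒ (α ◂ β)

-- The relation ∼◂ (elements of Form/∼◂ are represented by formulas,
-- the quotient being taken as a setoid)

infix 4 _∼◂_
_∼◂_ : Form → Form → Set
α ∼◂ β = (⊢ α ⇒ β) × (⊢ β ⇒ α)

record IsMVAlgebra {a ℓ} {A : Set a} (_≈_ : Rel A ℓ)
                   (_⊕_ : A → A → A) (_* : A → A) (𝟘 : A) : Set (a ⊔ ℓ) where
  field
    isEquivalence : IsEquivalence _≈_
    ⊕-cong : ∀ {x x′ y y′} → x ≈ x′ → y ≈ y′ → (x ⊕ y) ≈ (x′ ⊕ y′)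
    *-cong : ∀ {x x′} → x ≈ x′ → (x *) ≈ (x′ *)
    ⊕-assoc : ∀ x y z → ((x ⊕ y) ⊕ z) ≈ (x ⊕ (y ⊕ z))
    ⊕-comm  : ∀ x y → (x ⊕ y) ≈ (y ⊕ x)
    ⊕-zero  : ∀ x → (x ⊕ 𝟘) ≈ x
    *-invol : ∀ x → ((x *) *) ≈ x
    ⊕-one   : ∀ x → (x ⊕ (𝟘 *)) ≈ (𝟘 *)
    łuk     : ∀ x y → ((((x *) ⊕ y) *) ⊕ y) ≈ ((((y *) ⊕ x) *) ⊕ x)

record IsCMVAlgebra {a ℓ} {A : Set a} (_≈_ : Rel A ℓ)
                    (_⊕_ : A → A → A) (_* : A → A) (𝟘 : A)
                    (_⋄_ : A → A → A) (i : A) : Set (a ⊔ ℓ) where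
  field
    isMVAlgebra : IsMVAlgebra _≈_ _⊕_ _* 𝟘
    ⋄-isMonoid  : IsMonoid _≈_ _⋄_ i
    ⋄-distribʳ-⊕ : ∀ x y z → ((y ⊕ z) ⋄ x) ≈ ((y ⋄ x) ⊕ (z ⋄ x))
    *-⋄          : ∀ x y → ((x *) ⋄ y) ≈ ((x ⋄ y) *)
    𝟘-⋄          : ∀ x → (𝟘 ⋄ x) ≈ 𝟘

-- a representative of 1 = Th
⊤F : Form
⊤F = v ⇒ v

⊥F : Form
⊥F = ¬ ⊤F

_⊕F_ : Form → Form → Form
α ⊕F β = ¬ α ⇒ β

_*F : Form → Form
α *F = ¬ α

-- The proof has three layers.
--   1. Axioms Ax1–Ax4 with modus ponens form Łukasiewicz's implicational
--      calculus with negation; from them we derive the usual Hilbert-style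
--      facts (syllogism, identity, exchange, double negation, contraposition).
--   2. These make ∼◂ an equivalence and a congruence for ¬ and ⇒, and give
--      every MV-algebra law for x ⊕ y = ¬x ⇒ y, x* = ¬x, 0 = ¬⊤; the
--      Łukasiewicz law is exactly Ax3 read modulo double negation.
--   3. For ◂, left congruence comes from the ◂-rule and Ax9; right congruence
--      is proved by induction on the left factor, using that ◂ on the right
--      commutes with ¬ (Ax14/15), ⇒ (Ax10/11) and ◂ (Ax12/13).
module Submission where

open import Defs
open import Data.Product using (_×_; _,_; proj₂)
open import Function.Bundles using (_⇔_; mk⇔)
open import Level using (0ℓ)
open import Relation.Binary.Bundles using (Setoid)
open import Relation.Binary.Structures using (IsEquivalence)
open import Algebra.Structures using (IsMonoid)
import Relation.Binary.Reasoning.Setoid as SetoidReasoning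

-- 1. The implicational–negation fragment (Ax1–Ax4, modus ponens)

syllogism : ∀ {a b c} → ⊢ a ⇒ b → ⊢ b ⇒ c → ⊢ a ⇒ c
syllogism {a} {b} {c} a⇒b b⇒c = mp b⇒c (mp a⇒b (ax2 a b c))

weaken : ∀ {t} φ → ⊢ t → ⊢ φ ⇒ t
weaken {t} φ ⊢t = mp ⊢t (ax1 t φ)

-- A theorem may be discharged from an implication: ⊢ t gives (t ⇒ φ) ⇒ φ.
-- Ax3 turns the trivial (φ ⇒ t) ⇒ t into it.
discharge : ∀ {t} φ → ⊢ t → ⊢ (t ⇒ φ) ⇒ φ
discharge {t} φ ⊢t = mp (weaken (φ ⇒ t) ⊢t) (ax3 φ t)

-- A theorem available before identity is known (an instance of Ax1);
-- it serves as the constant to weaken with and then discharge.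
⊤₀ : Form
⊤₀ = v ⇒ (v ⇒ v)

⊢⊤₀ : ⊢ ⊤₀
⊢⊤₀ = ax1 v v

-- Identity: weaken φ to ⊤₀ ⇒ φ and discharge ⊤₀.
identity : ∀ φ → ⊢ φ ⇒ φ
identity φ = syllogism (ax1 φ ⊤₀) (discharge φ ⊢⊤₀)

assertion : ∀ φ ψ → ⊢ φ ⇒ ((φ ⇒ ψ) ⇒ ψ)
assertion φ ψ = syllogism (ax1 φ (ψ ⇒ φ)) (ax3 ψ φ)

suffix : ∀ {a b} c → ⊢ a ⇒ b → ⊢ (b ⇒ c) ⇒ (a ⇒ c)
suffix {a} {b} c a⇒b = mp a⇒b (ax2 a b c)

exchange : ∀ φ ψ χ → ⊢ (φ ⇒ (ψ ⇒ χ)) ⇒ (ψ ⇒ (φ ⇒ χ))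
exchange φ ψ χ = syllogism (ax2 φ (ψ ⇒ χ) χ) (suffix (φ ⇒ χ) (assertion ψ χ))

prefix : ∀ {b c} a → ⊢ b ⇒ c → ⊢ (a ⇒ b) ⇒ (a ⇒ c)
prefix {b} {c} a b⇒c = mp b⇒c (mp (ax2 a b c) (exchange (a ⇒ b) (b ⇒ c) (a ⇒ c)))

-- Double negation elimination: weaken ¬¬φ to ¬¬⊤₀ ⇒ ¬¬φ, contrapose twice
-- (Ax4) to ⊤₀ ⇒ φ, and discharge ⊤₀.
double-negation-elim : ∀ φ → ⊢ ¬ ¬ φ ⇒ φ
double-negation-elim φ =
  syllogism (ax1 (¬ ¬ φ) (¬ ¬ ⊤₀))
    (syllogism (ax4 (¬ ⊤₀) (¬ φ)) (syllogism (ax4 φ ⊤₀) (discharge φ ⊢⊤₀)))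

double-negation-intro : ∀ φ → ⊢ φ ⇒ ¬ ¬ φ
double-negation-intro φ = mp (double-negation-elim (¬ φ)) (ax4 (¬ ¬ φ) φ)

-- Contraposition, internalised: reduce to Ax4 via double negation.
contraposition : ∀ a b → ⊢ (a ⇒ b) ⇒ (¬ b ⇒ ¬ a)
contraposition a b =
  syllogism (suffix b (double-negation-elim a))
    (syllogism (prefix (¬ ¬ a) (double-negation-intro b)) (ax4 (¬ a) (¬ b)))

contrapose : ∀ {a b} → ⊢ a ⇒ b → ⊢ ¬ b ⇒ ¬ a
contrapose {a} {b} a⇒b = mp a⇒b (contraposition a b)

-- 2. The setoid Form/∼◂ and its MV-algebra structure

∼◂-isEquivalence : IsEquivalence _∼◂_
∼◂-isEquivalence = record
  { refl  = λ {a} → identity a , identity a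
  ; sym   = λ (a⇒b , b⇒a) → b⇒a , a⇒b
  ; trans = λ (a⇒b , b⇒a) (b⇒c , c⇒b) → syllogism a⇒b b⇒c , syllogism c⇒b b⇒a
  }

∼◂-setoid : Setoid 0ℓ 0ℓ
∼◂-setoid = record { isEquivalence = ∼◂-isEquivalence }

open IsEquivalence ∼◂-isEquivalence using () renaming (refl to ∼-refl; trans to ∼-trans)
open SetoidReasoning ∼◂-setoid

-- Any two theorems are equivalent: Th is a single class.
theorems-equivalent : ∀ {a b} → ⊢ a → ⊢ b → a ∼◂ b
theorems-equivalent {a} {b} ⊢a ⊢b = weaken a ⊢b , weaken b ⊢a

⊢⊤F : ⊢ ⊤F
⊢⊤F = identity v

¬-cong : ∀ {a b} → a ∼◂ b → ¬ a ∼◂ ¬ b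
¬-cong (a⇒b , b⇒a) = contrapose b⇒a , contrapose a⇒b

⇒-cong : ∀ {a a′ b b′} → a ∼◂ a′ → b ∼◂ b′ → (a ⇒ b) ∼◂ (a′ ⇒ b′)
⇒-cong {a} {a′} {b} {b′} (a⇒a′ , a′⇒a) (b⇒b′ , b′⇒b) =
  syllogism (suffix b a′⇒a) (prefix a′ b⇒b′) ,
  syllogism (suffix b′ a⇒a′) (prefix a b′⇒b)

double-negation : ∀ a → ¬ ¬ a ∼◂ a
double-negation a = double-negation-elim a , double-negation-intro a

-- One direction of ⊕-commutativity: ¬x ⇒ y gives ¬y ⇒ ¬¬x, i.e. ¬y ⇒ x.
⊕-comm-⇒ : ∀ x y → ⊢ (x ⊕F y) ⇒ (y ⊕F x)
⊕-comm-⇒ x y = syllogism (contraposition (¬ x) y) (prefix (¬ y) (double-negation-elim x))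

⊕-comm : ∀ x y → (x ⊕F y) ∼◂ (y ⊕F x)
⊕-comm x y = ⊕-comm-⇒ x y , ⊕-comm-⇒ y x

⊕-assoc : ∀ x y z → ((x ⊕F y) ⊕F z) ∼◂ (x ⊕F (y ⊕F z))
⊕-assoc x y z = begin
  (x ⊕F y) ⊕F z         ≈⟨ ⊕-comm (x ⊕F y) z ⟩
  ¬ z ⇒ (¬ x ⇒ y)       ≈⟨ (exchange (¬ z) (¬ x) y , exchange (¬ x) (¬ z) y) ⟩
  ¬ x ⇒ (¬ z ⇒ y)       ≈⟨ ⇒-cong ∼-refl (⊕-comm z y) ⟩
  x ⊕F (y ⊕F z)         ∎

-- 0 = ¬⊤ is neutral: ¬x ⇒ ¬⊤ is equivalent to ⊤ ⇒ x, i.e. to x.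
⊕-zero : ∀ x → (x ⊕F ⊥F) ∼◂ x
⊕-zero x =
  syllogism (ax4 x ⊤F) (discharge x ⊢⊤F) ,
  syllogism (ax1 x ⊤F) (contraposition ⊤F x)

-- 1 = 0* = ¬¬⊤ is a theorem, hence absorbing.
⊕-one : ∀ x → (x ⊕F (⊥F *F)) ∼◂ (⊥F *F)
⊕-one x = theorems-equivalent (weaken (¬ x) ⊢¬¬⊤) ⊢¬¬⊤
  where
    ⊢¬¬⊤ : ⊢ ¬ ¬ ⊤F
    ⊢¬¬⊤ = mp ⊢⊤F (double-negation-intro ⊤F)

-- Modulo double negation, (x* ⊕ y)* ⊕ y is the disjunction (x ⇒ y) ⇒ y.
łuk-as-disjunction : ∀ x y → ((((x *F) ⊕F y) *F) ⊕F y) ∼◂ ((x ⇒ y) ⇒ y)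
łuk-as-disjunction x y = begin
  ¬ ¬ (¬ ¬ x ⇒ y) ⇒ y   ≈⟨ ⇒-cong (double-negation (¬ ¬ x ⇒ y)) ∼-refl ⟩
  (¬ ¬ x ⇒ y) ⇒ y       ≈⟨ ⇒-cong (⇒-cong (double-negation x) ∼-refl) ∼-refl ⟩
  (x ⇒ y) ⇒ y           ∎

-- The Łukasiewicz law is Ax3, i.e. commutativity of that disjunction.
łukasiewicz : ∀ x y → ((((x *F) ⊕F y) *F) ⊕F y) ∼◂ ((((y *F) ⊕F x) *F) ⊕F x)
łukasiewicz x y = begin
  (((x *F) ⊕F y) *F) ⊕F y   ≈⟨ łuk-as-disjunction x y ⟩
  (x ⇒ y) ⇒ y               ≈⟨ (ax3 x y , ax3 y x) ⟩
  (y ⇒ x) ⇒ x               ≈⟨ łuk-as-disjunction y x ⟨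
  (((y *F) ⊕F x) *F) ⊕F x   ∎

isMVAlgebra : IsMVAlgebra _∼◂_ _⊕F_ _*F ⊥F
isMVAlgebra = record
  { isEquivalence = ∼◂-isEquivalence
  ; ⊕-cong  = λ x∼x′ y∼y′ → ⇒-cong (¬-cong x∼x′) y∼y′
  ; *-cong  = ¬-cong
  ; ⊕-assoc = ⊕-assoc
  ; ⊕-comm  = ⊕-comm
  ; ⊕-zero  = ⊕-zero
  ; *-invol = double-negation
  ; ⊕-one   = ⊕-one
  ; łuk     = łukasiewicz
  }

-- 3. The monoid ◂ and the CMV-algebra structure

-- Left congruence: the ◂-rule lifts x ⇒ y to (x ⇒ y) ◂ u, and Ax9 distributes.
◂-congˡ : ∀ {x y} u → x ∼◂ y → (x ◂ u) ∼◂ (y ◂ u)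
◂-congˡ {x} {y} u (x⇒y , y⇒x) =
  mp (◂-rule u x⇒y) (ax9 x y u) , mp (◂-rule u y⇒x) (ax9 y x u)

◂-identityˡ : ∀ x → (v ◂ x) ∼◂ x
◂-identityˡ x = ax6 x , ax7 x

◂-identityʳ : ∀ x → (x ◂ v) ∼◂ x
◂-identityʳ x = ax5 x , ax8 x

◂-assoc : ∀ x y z → ((x ◂ y) ◂ z) ∼◂ (x ◂ (y ◂ z))
◂-assoc x y z = ax13 x y z , ax12 x y z

-- Right multiplication commutes with negation (Ax14/15) …
¬-◂ : ∀ x y → (¬ x ◂ y) ∼◂ ¬ (x ◂ y)
¬-◂ x y = ax15 x y , ax14 x y

-- … with ⊕ (Ax10/11) …
⊕-◂ : ∀ x y z → ((y ⊕F z) ◂ x) ∼◂ ((y ◂ x) ⊕F (z ◂ x))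
⊕-◂ x y z = ax10 y z x , ax11 y z x

-- … and hence with implication, written as ¬¬δ ⇒ ε = ¬δ ⊕ ε.
⇒-◂ : ∀ δ ε γ → ((δ ⇒ ε) ◂ γ) ∼◂ ((δ ◂ γ) ⇒ (ε ◂ γ))
⇒-◂ δ ε γ = begin
  (δ ⇒ ε) ◂ γ               ≈⟨ ◂-congˡ γ (⇒-cong (double-negation δ) ∼-refl) ⟨
  ((¬ δ) ⊕F ε) ◂ γ          ≈⟨ ⊕-◂ γ (¬ δ) ε ⟩
  ¬ (¬ δ ◂ γ) ⇒ (ε ◂ γ)     ≈⟨ ⇒-cong (¬-cong (¬-◂ δ γ)) ∼-refl ⟩
  ¬ ¬ (δ ◂ γ) ⇒ (ε ◂ γ)     ≈⟨ ⇒-cong (double-negation (δ ◂ γ)) ∼-refl ⟩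
  (δ ◂ γ) ⇒ (ε ◂ γ)         ∎

-- Right congruence, by induction on the left factor: each connective of γ
-- commutes with right multiplication, and v is the unit.
◂-congʳ : ∀ γ {α β} → α ∼◂ β → (γ ◂ α) ∼◂ (γ ◂ β)
◂-congʳ v {α} {β} α∼β = begin
  v ◂ α   ≈⟨ ◂-identityˡ α ⟩
  α       ≈⟨ α∼β ⟩
  β       ≈⟨ ◂-identityˡ β ⟨
  v ◂ β   ∎
◂-congʳ (¬ δ) {α} {β} α∼β = begin
  ¬ δ ◂ α     ≈⟨ ¬-◂ δ α ⟩
  ¬ (δ ◂ α)   ≈⟨ ¬-cong (◂-congʳ δ α∼β) ⟩
  ¬ (δ ◂ β)   ≈⟨ ¬-◂ δ β ⟨
  ¬ δ ◂ β     ∎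
◂-congʳ (δ ⇒ ε) {α} {β} α∼β = begin
  (δ ⇒ ε) ◂ α             ≈⟨ ⇒-◂ δ ε α ⟩
  (δ ◂ α) ⇒ (ε ◂ α)       ≈⟨ ⇒-cong (◂-congʳ δ α∼β) (◂-congʳ ε α∼β) ⟩
  (δ ◂ β) ⇒ (ε ◂ β)       ≈⟨ ⇒-◂ δ ε β ⟨
  (δ ⇒ ε) ◂ β             ∎
◂-congʳ (δ ◂ ε) {α} {β} α∼β = begin
  (δ ◂ ε) ◂ α     ≈⟨ ◂-assoc δ ε α ⟩
  δ ◂ (ε ◂ α)     ≈⟨ ◂-congʳ δ (◂-congʳ ε α∼β) ⟩
  δ ◂ (ε ◂ β)     ≈⟨ ◂-assoc δ ε β ⟨
  (δ ◂ ε) ◂ β     ∎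

◂-isMonoid : IsMonoid _∼◂_ _◂_ v
◂-isMonoid = record
  { isSemigroup = record
    { isMagma = record
      { isEquivalence = ∼◂-isEquivalence
      ; ∙-cong = λ {x} {y} {u} {_} x∼y u∼w → ∼-trans (◂-congˡ u x∼y) (◂-congʳ y u∼w)
      }
    ; assoc = ◂-assoc
    }
  ; identity = ◂-identityˡ , ◂-identityʳ
  }

-- 0 ◂ x = ¬(⊤ ◂ x) = ¬⊤, since ⊤ ◂ x is a theorem by the ◂-rule.
⊥-◂ : ∀ x → (⊥F ◂ x) ∼◂ ⊥F
⊥-◂ x = ∼-trans (¬-◂ ⊤F x) (¬-cong (theorems-equivalent (◂-rule x ⊢⊤F) ⊢⊤F))

isCMVAlgebra : IsCMVAlgebra _∼◂_ _⊕F_ _*F ⊥F _◂_ v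
isCMVAlgebra = record
  { isMVAlgebra  = isMVAlgebra
  ; ⋄-isMonoid   = ◂-isMonoid
  ; ⋄-distribʳ-⊕ = ⊕-◂
  ; *-⋄          = ¬-◂
  ; 𝟘-⋄          = ⊥-◂
  }

-- The top element 1 = |⊤| is exactly Th.
derivable⇔top : (α : Form) → (⊢ α) ⇔ (α ∼◂ ⊤F)
derivable⇔top α = mk⇔ (λ ⊢α → theorems-equivalent ⊢α ⊢⊤F) (λ α∼⊤ → mp ⊢⊤F (proj₂ α∼⊤))

mainTheorem17 : ((α : Form) → (⊢ α) ⇔ (α ∼◂ ⊤F))
    × IsCMVAlgebra _∼◂_ _⊕F_ _*F ⊥F _◂_ v
mainTheorem17 = derivable⇔top , isCMVAlgebra
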